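{- Let $n\ge 1$ and let $m=(m_0,m_1,\dots,m_n)$ be a sequence of non-negative integers. Define the $(m_0+1)\times(m_n+1)$ matrix \[ M_m := R_{m_0,m_0}R_{m_0,m_1}R_{m_1,m_2}\cdots R_{m_{n-1},m_n}. \] Then for all $1\le i\le m_0+1$ and $1\le j\le m_n+1$, the $(i,j)$-entry of $M_m$ equals $\left|\Omega^{ij}_{\mathbf{n}_m}(\mathcal{G}^s_n)\right|$. In particular, the $(1,1)$-entry of $M_m$ equals $\left|\Omega_{\mathbf{n}_m}(\mathcal{G}^s_n)\right|$.
   Context: Mixed dimer covers: for a finite graph $\mathcal{G}=(V,E)$ and a function $\mathbf{n}\colon V\to\mathbb{N}$, an $\mathbf{n}$-dimer cover is a function $\mathbf{m}\colon E\to\mathbb{N}$ (edge multiplicities) such that $\sum_{e\ni v}\mathbf{m}(e)=\mathbf{n}(v)$ for every vertex $v$; the set of these is $\Omega_{\mathbf{n}}(\mathcal{G})$. The straight snake graph $\mathcal{G}^s_n$ is the $2\times(n+1)$ grid graph with bottom vertices $v_{1,0},\dots,v_{1,n}$ and top vertices $v_{2,0},\dots,v_{2,n}$, with vertical edges $v_{1,k}v_{2,k}$ ($0\le k\le n$) and horizontal edges $v_{r,k-1}v_{r,k}$ ($r=1,2$, $1\le k\le n$). For a sequence $x=(x_0,\dots,x_n)$ of non-negative integers, $\mathbf{n}_x$ is the vertex labeling with $\mathbf{n}_x(v_{1,k})=\mathbf{n}_x(v_{2,k})=x_k$. For $m=(m_0,\dots,m_n)$, $\Omega^{ij}_{\mathbf{n}_m}(\mathcal{G}^s_n):=\Omega_{\mathbf{n}_{m'}}(\mathcal{G}^s_n)$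 where $m'=(m_0+1-i,m_1,m_2,\dots,m_{n-1},m_n+1-j)$ (empty if an entry is negative). For non-negative integers $a,b$, $R_{a,b}$ is the $(a+1)\times(b+1)$ matrix whose $(i,j)$-entry is $1$ if $i+j\le b+2$ and $0$ otherwise. -}

module Defs where

open import Data.Nat using (ℕ; zero; suc; _+_; _*_; _∸_; _≤_; _≤ᵇ_)
open import Data.Bool using (Bool; true; false; if_then_else_; _∨_)
open import Data.Fin using (Fin; zero; suc; toℕ; fromℕ; inject₁; splitAt; combine; remQuot)
open import Data.Fin.Properties using () renaming (_≟_ to _≟F_)
open import Data.Vec using (Vec; lookup)
open import Data.List using (List; allFin)
open import Data.List.Relation.Unary.All using (All)
open import Data.Product using (Σ; _×_; _,_; proj₁; proj₂)
open import Data.Sum using (inj₁; inj₂)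
open import Relation.Binary.PropositionalEquality using (_≡_)
open import Relation.Nullary.Decidable using (⌊_⌋; yes; no)
open import Data.Nat.Properties using () renaming (_≟_ to _≟ℕ_)
open import Function.Bundles using (_↔_)

sumFin : (k : ℕ) → (Fin k → ℕ) → ℕ
sumFin zero    f = 0
sumFin (suc k) f = f zero + sumFin k (λ i → f (suc i))

record Graph : Set where
  field
    nv   : ℕ
    ne   : ℕ
    ends : Fin ne → Fin nv × Fin nv

open Graph public

allVertices : (k : ℕ) → List (Fin k)
allVertices k = allFin k

incident : (G : Graph) → Fin (ne G) → Fin (nv G) → Bool
incident G e v = ⌊ proj₁ (ends G e) ≟F v ⌋ ∨ ⌊ proj₂ (ends G e) ≟F v ⌋

degree : (G : Graph) → Vec ℕ (ne G) → Fin (nv G) → ℕ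
degree G m v = sumFin (ne G) (λ e → if incident G e v then lookup m e else 0)

IsDimerCover : (G : Graph) → (Fin (nv G) → ℕ) → Vec ℕ (ne G) → Set
IsDimerCover G n m = All (λ v → degree G m v ≡ n v) (allVertices (nv G))

Ω : (G : Graph) → (Fin (nv G) → ℕ) → Set
Ω G n = Σ (Vec ℕ (ne G)) (IsDimerCover G n)

HasCard : Set → ℕ → Set
HasCard A k = A ↔ Fin k

-- Straight snake graph G^s_n: the 2 × (n+1) grid.
-- Vertex v_{r+1,k} (r : Fin 2, k : Fin (n+1)) is encoded as  combine r k.
-- Edges: first the n+1 vertical edges v_{1,k}v_{2,k}, then the n bottom
-- horizontal edges v_{1,k-1}v_{1,k}, then the n top horizontal edges.

snakeVertex : (n : ℕ) → Fin 2 → Fin (suc n) → Fin (2 * suc n)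
snakeVertex n r k = combine r k

snakeEnds : (n : ℕ) → Fin (suc n + (n + n)) → Fin (2 * suc n) × Fin (2 * suc n)
snakeEnds n e with splitAt (suc n) e
... | inj₁ k = snakeVertex n zero k , snakeVertex n (suc zero) k
... | inj₂ h with splitAt n h
...   | inj₁ k = snakeVertex n zero (inject₁ k) , snakeVertex n zero (suc k)
...   | inj₂ k = snakeVertex n (suc zero) (inject₁ k) , snakeVertex n (suc zero) (suc k)

snakeGraph : ℕ → Graph
snakeGraph n = record { nv = 2 * suc n ; ne = suc n + (n + n) ; ends = snakeEnds n }

column : (n : ℕ) → Fin (2 * suc n) → Fin (suc n)
column n v = proj₂ (remQuot {2} (suc n) v)

labelOf : (n : ℕ) → (Fin (suc n) → ℕ) → Fin (nv (snakeGraph n)) → ℕ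
labelOf n x v = x (column n v)

-- Ω^{ij}_{n_m}(G^s_n), with 1-based i, j given as 0-based i', j' : Fin _
-- (i = i'+1, j = j'+1), so m_0 + 1 - i = m_0 ∸ i' (never negative here).
-- m' = (m_0+1-i, m_1, …, m_{n-1}, m_n+1-j);  this is used for n ≥ 1.

modSeq : (n : ℕ) (m : Fin (suc n) → ℕ) → Fin (suc (m zero)) → Fin (suc (m (fromℕ n)))
       → Fin (suc n) → ℕ
modSeq n m i j k with toℕ k ≟ℕ 0
... | yes _ = m zero ∸ toℕ i
... | no _ with toℕ k ≟ℕ n
...   | yes _ = m (fromℕ n) ∸ toℕ j
...   | no _ = m k

Ωij : (n : ℕ) (m : Fin (suc n) → ℕ) → Fin (suc (m zero)) → Fin (suc (m (fromℕ n))) → Set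
Ωij n m i j = Ω (snakeGraph n) (labelOf n (modSeq n m i j))

Mat : ℕ → ℕ → Set
Mat p q = Fin p → Fin q → ℕ

_⊗_ : ∀ {p q r} → Mat p q → Mat q r → Mat p r
_⊗_ {q = q} A B i k = sumFin q (λ j → A i j * B j k)

-- R_{a,b}: (a+1)×(b+1), entry (i,j) (1-based) is 1 iff i + j ≤ b + 2,
-- i.e. with 0-based indices i', j': 1 iff i' + j' ≤ b.
R : (a b : ℕ) → Mat (suc a) (suc b)
R a b i j = if (toℕ i + toℕ j) ≤ᵇ b then 1 else 0

Mprod : (n : ℕ) (m : Fin (suc n) → ℕ) → Mat (suc (m zero)) (suc (m (fromℕ n)))
Mprod zero    m = R (m zero) (m zero)
Mprod (suc n) m = Mprod n (λ k → m (inject₁ k)) ⊗ R (m (inject₁ (fromℕ n))) (m (fromℕ (suc n)))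

{-# OPTIONS --safe #-}
-- A dimer cover of the 2 × (n+1) ladder with both vertices of column k labelled x k is determined
-- by its bottom rail c₀, …, c_{n-1}: the degree conditions at the two vertices of each column force
-- the top rail to agree with the bottom one, column by column from the left, and the rung of
-- column k to carry x k − (c_{k-1} + c_k).  So covers correspond to chains: sequences with
-- c_{k-1} + c_k ≤ x k for every column, where c_{-1} = c_n = 0.  On the other side, R a b has
-- entry 1 exactly when its two 0-based indices sum to at most b, so expanding the product M_m
-- shows that its (i, j)-entry, indexed from 0, counts chains for m with boundary values
-- c_{-1} = i and c_n = j.
-- Lowering m₀ by i and m_n by j turns these into chains with zero boundary values; this needs
-- n ≥ 1, so that the first and last columns are different.

module Submission where

open import Defs
open import Data.Bool using (true; false; if_then_else_; _∨_; _∧_; T)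
open import Data.Bool.Properties using (∨-identityʳ; ∧-distribˡ-∨; T-irrelevant)
open import Data.Nat using (ℕ; zero; suc; _+_; _*_; _∸_; _≤_; _≤ᵇ_; s≤s; s≤s⁻¹)
open import Data.Nat.Properties
  using (≤-irrelevant; ≡-irrelevant; +-assoc; ≤ᵇ⇒≤; ≤⇒≤ᵇ; +-identityʳ; +-comm; +-cancelˡ-≡;
         m≤n+m; m+n≤o⇒n≤o; m+n≤o⇒m≤o∸n; m≤o∸n⇒m+n≤o; m+n∸n≡m; m∸n+n≡m; suc-injective)
  renaming (_≟_ to _≟ℕ_)
open import Data.Fin using (Fin; zero; suc; toℕ; fromℕ; fromℕ<; inject₁; combine; remQuot; _↑ˡ_; _↑ʳ_)
open import Data.Fin.Properties
  using (_≟_; 0↔⊥; 1↔⊤; +↔⊎; *↔×; toℕ<n; toℕ-fromℕ; toℕ-fromℕ<; toℕ-inject₁-≢;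
         toℕ-injective; splitAt-↑ˡ; splitAt-↑ʳ; combine-injective; remQuot-combine; combine-remQuot)
open import Data.Vec using (Vec; []; _∷_; lookup; tabulate; _++_; take; drop; _∷ʳ_; init; last; initLast)
open import Data.Vec.Properties
  using (++-injective; take++drop≡id; init-∷ʳ; last-∷ʳ; lookup-++ˡ; lookup-++ʳ;
         lookup∘tabulate; tabulate∘lookup; tabulate-cong)
import Data.List.Relation.Unary.All as All
open import Data.List.Relation.Unary.All.Properties using (tabulate⁺; tabulate⁻)
open import Data.Product using (Σ; _×_; _,_; proj₁; proj₂; uncurry; map₂; assocʳ′; assocˡ′)
open import Data.Product.Algebra using (Σ-assoc; ×-cong; ×-comm)
open import Data.Product.Function.Dependent.Propositional using (Σ-↔)
open import Data.Product.Function.NonDependent.Propositional using (_×-⇔_)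
open import Data.Sum using (_⊎_; inj₁; inj₂)
open import Data.Sum.Function.Propositional using (_⊎-↔_)
open import Function using (_∘_; id)
open import Function.Bundles using (_↔_; _⇔_; mk↔ₛ′; mk⇔; Equivalence)
open import Function.Properties.Inverse using (↔-refl; ↔-sym; ↔-trans)
open import Function.Properties.Equivalence using () renaming (refl to ⇔-refl; sym to ⇔-sym)
open import Function.Related.Propositional using (bijection; module EquationalReasoning)
open import Relation.Binary.PropositionalEquality
  using (_≡_; _≢_; refl; sym; trans; cong; cong₂; subst; subst₂; module ≡-Reasoning)
open import Relation.Nullary using (does; yes; no)
open import Relation.Nullary.Decidable using (⌊_⌋)
open import Relation.Nullary.Irrelevant using (Irrelevant)
open import Data.Empty using (⊥-elim)

⇔⇒↔ : {A B : Set} → Irrelevant A → Irrelevant B → A ⇔ B → A ↔ B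
⇔⇒↔ irrA irrB A⇔B = mk↔ₛ′ to from (λ b → irrB _ b) (λ a → irrA _ a)
  where open Equivalence A⇔B

×-irrelevant : {A B : Set} → Irrelevant A → Irrelevant B → Irrelevant (A × B)
×-irrelevant irrA irrB (a , b) (a′ , b′) = cong₂ _,_ (irrA a a′) (irrB b b′)

Σ-congʳ-⇔ : {A : Set} {P Q : A → Set} → (∀ {a} → Irrelevant (P a)) → (∀ {a} → Irrelevant (Q a))
          → (∀ {a} → P a ⇔ Q a) → Σ A P ↔ Σ A Q
Σ-congʳ-⇔ irrP irrQ P⇔Q = Σ-↔ ↔-refl (⇔⇒↔ irrP irrQ P⇔Q)

Σ-≡-irrelevant : {A : Set} {P : A → Set} → (∀ {a} → Irrelevant (P a))
               → {a b : A} {p : P a} {q : P b} → a ≡ b → (a , p) ≡ (b , q)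
Σ-≡-irrelevant irr {p = p} {q} refl = cong (_ ,_) (irr p q)

subtype-↔ : {X Y : Set} {P : X → Set} {Q : Y → Set}
          → (∀ {x} → Irrelevant (P x)) → (∀ {y} → Irrelevant (Q y))
          → (f : X → Y) (g : Y → X) → (∀ {x} → P x → Q (f x)) → (∀ {y} → Q y → P (g y))
          → (∀ {x} → P x → g (f x) ≡ x) → (∀ {y} → Q y → f (g y) ≡ y)
          → Σ X P ↔ Σ Y Q
subtype-↔ irrP irrQ f g P⇒Q Q⇒P gf fg = mk↔ₛ′
  (λ (x , p) → f x , P⇒Q p) (λ (y , q) → g y , Q⇒P q)
  (λ (y , q) → Σ-≡-irrelevant irrQ (fg q)) (λ (x , p) → Σ-≡-irrelevant irrP (gf p))

Σ-Fin↔Σ-ℕ : ∀ {q} {P : ℕ → Set} → (∀ {c} → P c → c ≤ q)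
          → Σ (Fin (suc q)) (P ∘ toℕ) ↔ Σ ℕ P
Σ-Fin↔Σ-ℕ {q} {P} bound = mk↔ₛ′ (λ (j , p) → toℕ j , p) from
  (λ (c , p) → reindexℕ (toℕ-fromℕ< (s≤s (bound p))) p)
  (λ (j , p) → reindexFin _ j (toℕ-fromℕ< (s≤s (bound p))) p)
  where
  from : Σ ℕ P → Σ (Fin (suc q)) (P ∘ toℕ)
  from (c , p) = fromℕ< (s≤s (bound p)) , subst P (sym (toℕ-fromℕ< (s≤s (bound p)))) p
  reindexℕ : ∀ {a c} (e : a ≡ c) (p : P c) → (a , subst P (sym e) p) ≡ (c , p)
  reindexℕ refl p = refl
  reindexFin : ∀ j′ j (e : toℕ j′ ≡ toℕ j) (p : P (toℕ j)) → (j′ , subst P (sym e) p) ≡ (j , p)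
  reindexFin j′ j e p with toℕ-injective e
  ... | refl rewrite ≡-irrelevant e refl = refl

++-↔ : ∀ {A : Set} m {n} → (Vec A m × Vec A n) ↔ Vec A (m + n)
++-↔ m = mk↔ₛ′ (uncurry _++_) (λ v → take m v , drop m v) (take++drop≡id m) split-++
  where
  split-++ : ∀ p → (take m (uncurry _++_ p) , drop m (uncurry _++_ p)) ≡ p
  split-++ (xs , ys) with ++-injective (take m (xs ++ ys)) xs (take++drop≡id m (xs ++ ys))
  ... | e₁ , e₂ = cong₂ _,_ e₁ e₂

∷ʳ-↔ : ∀ {A : Set} {n} → (Vec A n × A) ↔ Vec A (suc n)
∷ʳ-↔ = mk↔ₛ′ (uncurry _∷ʳ_) (λ v → init v , last v)
  (λ v → sym (proj₂ (proj₂ (initLast v)))) (λ (xs , x) → cong₂ _,_ (init-∷ʳ x xs) (last-∷ʳ x xs))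

sumFin-cong : ∀ N {f g : Fin N → ℕ} → (∀ k → f k ≡ g k) → sumFin N f ≡ sumFin N g
sumFin-cong zero    f≗g = refl
sumFin-cong (suc N) f≗g = cong₂ _+_ (f≗g zero) (sumFin-cong N (f≗g ∘ suc))

sumFin-zeros : ∀ N → sumFin N (λ _ → 0) ≡ 0
sumFin-zeros zero    = refl
sumFin-zeros (suc N) = sumFin-zeros N

sumFin-splitAt : ∀ a b (f : Fin (a + b) → ℕ)
               → sumFin (a + b) f ≡ sumFin a (f ∘ (_↑ˡ b)) + sumFin b (f ∘ (a ↑ʳ_))
sumFin-splitAt zero    b f = refl
sumFin-splitAt (suc a) b f =
  trans (cong (f zero +_) (sumFin-splitAt a b (f ∘ suc))) (sym (+-assoc (f zero) _ _))

sumFin-indicator : ∀ N (f : Fin N → ℕ) k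
                 → sumFin N (λ k′ → if does (k′ ≟ k) then f k′ else 0) ≡ f k
sumFin-indicator (suc N) f zero    = trans (cong (f zero +_) (sumFin-zeros N)) (+-identityʳ (f zero))
sumFin-indicator (suc N) f (suc k) = sumFin-indicator N (f ∘ suc) k

Fin-sumFin↔Σ : ∀ q (F : Fin q → ℕ) → Fin (sumFin q F) ↔ Σ (Fin q) (Fin ∘ F)
Fin-sumFin↔Σ zero    F = mk↔ₛ′ (λ ()) (λ ()) (λ ()) (λ ())
Fin-sumFin↔Σ (suc q) F = ↔-trans +↔⊎ (↔-trans (↔-refl ⊎-↔ Fin-sumFin↔Σ q (F ∘ suc)) split)
  where
  split : (Fin (F zero) ⊎ Σ (Fin q) (Fin ∘ F ∘ suc)) ↔ Σ (Fin (suc q)) (Fin ∘ F)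
  split = mk↔ₛ′ (λ { (inj₁ a) → zero , a ; (inj₂ (j , a)) → suc j , a })
                (λ { (zero , a) → inj₁ a ; (suc j , a) → inj₂ (j , a) })
                (λ { (zero , a) → refl ; (suc j , a) → refl })
                (λ { (inj₁ a) → refl ; (inj₂ (j , a)) → refl })

Fin-⊗↔Σ : ∀ {p q r} (A : Mat p q) (B : Mat q r) i k
        → Fin ((A ⊗ B) i k) ↔ Σ (Fin q) (λ j → Fin (A i j) × Fin (B j k))
Fin-⊗↔Σ {q = q} A B i k = ↔-trans (Fin-sumFin↔Σ q _) (Σ-↔ ↔-refl *↔×)

Fin-R↔≤ : ∀ a b (i : Fin (suc a)) (j : Fin (suc b)) → Fin (R a b i j) ↔ (toℕ i + toℕ j ≤ b)
Fin-R↔≤ a b i j =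
  ↔-trans (Fin-if (toℕ i + toℕ j ≤ᵇ b)) (⇔⇒↔ T-irrelevant ≤-irrelevant (mk⇔ (≤ᵇ⇒≤ _ _) ≤⇒≤ᵇ))
  where
  Fin-if : ∀ c → Fin (if c then 1 else 0) ↔ T c
  Fin-if true  = 1↔⊤
  Fin-if false = 0↔⊥

Chain : ∀ {n} → (Fin (suc n) → ℕ) → ℕ → ℕ → Vec ℕ n → Set
Chain x i j []       = i + j ≤ x zero
Chain x i j (c ∷ cs) = i + c ≤ x zero × Chain (x ∘ suc) c j cs

Chain-irrelevant : ∀ {n} {x : Fin (suc n) → ℕ} {i j} {cs : Vec ℕ n} → Irrelevant (Chain x i j cs)
Chain-irrelevant {cs = []}     = ≤-irrelevant
Chain-irrelevant {cs = c ∷ cs} = ×-irrelevant ≤-irrelevant Chain-irrelevant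

Chain-last-≤ : ∀ {n} {x : Fin (suc n) → ℕ} {i j} (cs : Vec ℕ n) → Chain x i j cs → j ≤ x (fromℕ n)
Chain-last-≤ {i = i} []       p       = m+n≤o⇒n≤o i p
Chain-last-≤         (c ∷ cs) (_ , p) = Chain-last-≤ cs p

Chain-∷ʳ : ∀ {n} (x : Fin (suc (suc n)) → ℕ) i k (cs : Vec ℕ n) c
         → Chain x i k (cs ∷ʳ c) ⇔ (Chain (x ∘ inject₁) i c cs × c + k ≤ x (fromℕ (suc n)))
Chain-∷ʳ x i k []       c = ⇔-refl
Chain-∷ʳ x i k (a ∷ cs) c = mk⇔ (assocˡ′ ∘ map₂ to) (map₂ from ∘ assocʳ′)
  where open Equivalence (Chain-∷ʳ (x ∘ suc) a k cs c)

+-≤⇔≤-∸ : ∀ {m n o} → n ≤ o → (m + n ≤ o ⇔ m ≤ o ∸ n)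
+-≤⇔≤-∸ {m} n≤o = mk⇔ (m+n≤o⇒m≤o∸n m) (m≤o∸n⇒m+n≤o m n≤o)

Chain-∸-last : ∀ {n} {x y : Fin (suc n) → ℕ} {i j} (cs : Vec ℕ n)
             → j ≤ x (fromℕ n) → (∀ k → y (inject₁ k) ≡ x (inject₁ k))
             → y (fromℕ n) ≡ x (fromℕ n) ∸ j
             → Chain x i j cs ⇔ Chain y i 0 cs
Chain-∸-last {i = i} [] j≤x _ y≡x∸j = mk⇔
  (λ p → subst₂ _≤_ (sym (+-identityʳ i)) (sym y≡x∸j) (to p))
  (λ p → from (subst₂ _≤_ (+-identityʳ i) y≡x∸j p))
  where open Equivalence (+-≤⇔≤-∸ {i} j≤x)
Chain-∸-last {i = i} (c ∷ cs) j≤x y≡x y≡x∸j =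
  mk⇔ (subst (i + c ≤_) (sym (y≡x zero))) (subst (i + c ≤_) (y≡x zero))
  ×-⇔ Chain-∸-last cs j≤x (y≡x ∘ suc) y≡x∸j

-- adjacentSum i j cs k is the sum of the entries k and k + 1 of the padded sequence i ∷ cs ∷ʳ j.
adjacentSum : ∀ {n} → ℕ → ℕ → Vec ℕ n → Fin (suc n) → ℕ
adjacentSum i j []       zero    = i + j
adjacentSum i j (c ∷ cs) zero    = i + c
adjacentSum i j (c ∷ cs) (suc k) = adjacentSum c j cs k

Chain⇒adjacentSum≤ : ∀ {n} {x : Fin (suc n) → ℕ} {i j} (cs : Vec ℕ n)
                   → Chain x i j cs → ∀ k → adjacentSum i j cs k ≤ x k
Chain⇒adjacentSum≤ []       p       zero    = p
Chain⇒adjacentSum≤ (c ∷ cs) (p , _) zero    = p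
Chain⇒adjacentSum≤ (c ∷ cs) (_ , q) (suc k) = Chain⇒adjacentSum≤ cs q k

adjacentSum≤⇒Chain : ∀ {n} {x : Fin (suc n) → ℕ} {i j} (cs : Vec ℕ n)
                   → (∀ k → adjacentSum i j cs k ≤ x k) → Chain x i j cs
adjacentSum≤⇒Chain []       ≤x = ≤x zero
adjacentSum≤⇒Chain (c ∷ cs) ≤x = ≤x zero , adjacentSum≤⇒Chain cs (≤x ∘ suc)

adjacentSum-injective : ∀ {n i j} (cs ds : Vec ℕ n)
                      → (∀ k → adjacentSum i j cs k ≡ adjacentSum i j ds k) → cs ≡ ds
adjacentSum-injective []       []       _ = refl
adjacentSum-injective {i = i} (c ∷ cs) (d ∷ ds) eq with +-cancelˡ-≡ i c d (eq zero)
... | refl = cong (c ∷_) (adjacentSum-injective cs ds (eq ∘ suc))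

adjacentSum-head : ∀ {n} i j (cs : Vec ℕ n) k
                 → adjacentSum i j cs k ≡ (if does (zero ≟ k) then i else 0) + adjacentSum 0 j cs k
adjacentSum-head i j []       zero    = refl
adjacentSum-head i j (c ∷ cs) zero    = refl
adjacentSum-head i j (c ∷ cs) (suc k) = refl

Fin-Mprod↔Chains : ∀ n (m : Fin (suc n) → ℕ) i j
                 → Fin (Mprod n m i j) ↔ Σ (Vec ℕ n) (Chain m (toℕ i) (toℕ j))
Fin-Mprod↔Chains zero    m i j = ↔-trans (Fin-R↔≤ (m zero) (m zero) i j) Vec0
  where
  Vec0 : {P : Vec ℕ 0 → Set} → P [] ↔ Σ (Vec ℕ 0) P
  Vec0 = mk↔ₛ′ ([] ,_) (λ { ([] , p) → p }) (λ { ([] , p) → refl }) (λ _ → refl)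
Fin-Mprod↔Chains (suc n) m i k =
  begin
    Fin (Mprod (suc n) m i k)
  ↔⟨ Fin-⊗↔Σ (Mprod n m′) (R q L) i k ⟩
    Σ (Fin (suc q)) (λ j → Fin (Mprod n m′ i j) × Fin (R q L j k))
  ↔⟨ Σ-↔ ↔-refl (×-cong (Fin-Mprod↔Chains n m′ i _) (Fin-R↔≤ q L _ k)) ⟩
    Σ (Fin (suc q)) (λ j → Σ (Vec ℕ n) (Chain m′ ι (toℕ j)) × (toℕ j + κ ≤ L))
  ↔⟨ Σ-Fin↔Σ-ℕ (λ ((cs , p) , _) → Chain-last-≤ cs p) ⟩
    Σ ℕ (λ c → Σ (Vec ℕ n) (Chain m′ ι c) × (c + κ ≤ L))
  ↔⟨ Σ-↔ ↔-refl Σ-assoc ⟩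
    Σ ℕ (λ c → Σ (Vec ℕ n) (λ cs → Chain m′ ι c cs × (c + κ ≤ L)))
  ↔⟨ ↔-sym Σ-assoc ⟩
    Σ (ℕ × Vec ℕ n) (λ (c , cs) → Chain m′ ι c cs × (c + κ ≤ L))
  ↔⟨ Σ-↔ (↔-trans (×-comm ℕ (Vec ℕ n)) ∷ʳ-↔)
         (⇔⇒↔ (×-irrelevant Chain-irrelevant ≤-irrelevant) Chain-irrelevant
              (⇔-sym (Chain-∷ʳ m ι κ _ _))) ⟩
    Σ (Vec ℕ (suc n)) (Chain m ι κ)
  ∎
  where
  open EquationalReasoning {k = bijection}
  m′ : Fin (suc n) → ℕ
  m′ = m ∘ inject₁
  q = m′ (fromℕ n)
  L = m (fromℕ (suc n))
  ι = toℕ i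
  κ = toℕ k

-- degree G m v unfolds to edgeSum (ends G) (lookup m) v.
edgeSum : ∀ {N M} → (Fin N → Fin M × Fin M) → (Fin N → ℕ) → Fin M → ℕ
edgeSum {N} ends w v =
  sumFin N (λ e → if ⌊ proj₁ (ends e) ≟ v ⌋ ∨ ⌊ proj₂ (ends e) ≟ v ⌋ then w e else 0)

edgeSum-splitAt : ∀ {M} a b (ends : Fin (a + b) → Fin M × Fin M) w v
                → edgeSum ends w v ≡ edgeSum (ends ∘ (_↑ˡ b)) (w ∘ (_↑ˡ b)) v
                                     + edgeSum (ends ∘ (a ↑ʳ_)) (w ∘ (a ↑ʳ_)) v
edgeSum-splitAt a b ends w v = sumFin-splitAt a b _

edgeSum-cong : ∀ {N M} {ends ends′ : Fin N → Fin M × Fin M} {w w′ : Fin N → ℕ}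
             → (∀ e → ends e ≡ ends′ e) → (∀ e → w e ≡ w′ e)
             → ∀ v → edgeSum ends w v ≡ edgeSum ends′ w′ v
edgeSum-cong {N} ends≗ w≗ v =
  sumFin-cong N (λ e → cong₂ (λ (p , q) x → if ⌊ p ≟ v ⌋ ∨ ⌊ q ≟ v ⌋ then x else 0) (ends≗ e) (w≗ e))

combine-≟ : ∀ {p q} (a c : Fin p) (b d : Fin q)
          → ⌊ combine a b ≟ combine c d ⌋ ≡ does (a ≟ c) ∧ does (b ≟ d)
combine-≟ a c b d with combine a b ≟ combine c d | a ≟ c | b ≟ d
... | yes _  | yes _    | yes _    = refl
... | yes e  | no a≢c   | _        = ⊥-elim (a≢c (proj₁ (combine-injective a b c d e)))
... | yes e  | yes _    | no b≢d   = ⊥-elim (b≢d (proj₂ (combine-injective a b c d e)))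
... | no ab≢ | yes refl | yes refl = ⊥-elim (ab≢ refl)
... | no _   | yes _    | no _     = refl
... | no _   | no _     | _        = refl

adjacentSum-incidence : ∀ {n} (H : Vec ℕ n) k
  → sumFin n (λ h → if does (inject₁ h ≟ k) ∨ does (suc h ≟ k) then lookup H h else 0)
    ≡ adjacentSum 0 0 H k
adjacentSum-incidence []       zero    = refl
adjacentSum-incidence {suc n} (c ∷ H) zero = trans (cong (c +_) (sumFin-zeros n)) (+-identityʳ c)
adjacentSum-incidence (c ∷ H) (suc k) =
  trans (cong (_ +_) (adjacentSum-incidence H k)) (sym (adjacentSum-head c 0 H k))

-- The snake graph is a ladder: rows bottom and top are the paper's rows 1 and 2, the rungs are
-- the vertical edges and the rails the horizontal ones, numbered as in snakeEnds.
bottom top : Fin 2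
bottom = zero
top    = suc zero

module _ {n : ℕ} where

  rungs : Fin (suc n) → Fin (2 * suc n) × Fin (2 * suc n)
  rungs k = combine bottom k , combine top k

  rails : Fin 2 → Fin n → Fin (2 * suc n) × Fin (2 * suc n)
  rails r h = combine r (inject₁ h) , combine r (suc h)

  edgeSum-rungs : ∀ (w : Fin (suc n) → ℕ) r k → edgeSum rungs w (combine r k) ≡ w k
  edgeSum-rungs w r k =
    trans (sumFin-cong (suc n) (λ k′ → cong (if_then w k′ else 0) (incident-rung r k′)))
          (sumFin-indicator (suc n) w k)
    where
    incident-rung : ∀ (r : Fin 2) k′
                  → ⌊ combine bottom k′ ≟ combine r k ⌋ ∨ ⌊ combine top k′ ≟ combine r k ⌋
                    ≡ does (k′ ≟ k)
    incident-rung r k′ rewrite combine-≟ bottom r k′ k | combine-≟ top r k′ k with r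
    ... | zero     = ∨-identityʳ _
    ... | suc zero = refl

  edgeSum-rails : ∀ (H : Vec ℕ n) r′ r k
    → edgeSum (rails r′) (lookup H) (combine r k) ≡ (if does (r′ ≟ r) then adjacentSum 0 0 H k else 0)
  edgeSum-rails H r′ r k = trans (sumFin-cong n (λ h → cong (if_then lookup H h else 0) (incident-rail h)))
                                 (restrict (does (r′ ≟ r)))
    where
    incident-rail : ∀ h
                  → ⌊ combine r′ (inject₁ h) ≟ combine r k ⌋ ∨ ⌊ combine r′ (suc h) ≟ combine r k ⌋
                    ≡ does (r′ ≟ r) ∧ (does (inject₁ h ≟ k) ∨ does (suc h ≟ k))
    incident-rail h rewrite combine-≟ r′ r (inject₁ h) k | combine-≟ r′ r (suc h) k =
      sym (∧-distribˡ-∨ (does (r′ ≟ r)) (does (inject₁ h ≟ k)) (does (suc h ≟ k)))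
    restrict : ∀ b
             → sumFin n (λ h → if b ∧ (does (inject₁ h ≟ k) ∨ does (suc h ≟ k)) then lookup H h else 0)
               ≡ (if b then adjacentSum 0 0 H k else 0)
    restrict true  = adjacentSum-incidence H k
    restrict false = sumFin-zeros n

  rungEdge : Fin (suc n) → Fin (suc n + (n + n))
  rungEdge k = k ↑ˡ (n + n)

  railEdge : Fin 2 → Fin n → Fin (suc n + (n + n))
  railEdge zero       h = suc n ↑ʳ (h ↑ˡ n)
  railEdge (suc zero) h = suc n ↑ʳ (n ↑ʳ h)

  ends-rung : ∀ k → snakeEnds n (rungEdge k) ≡ rungs k
  ends-rung k rewrite splitAt-↑ˡ (suc n) k (n + n) = refl

  ends-rail : ∀ r h → snakeEnds n (railEdge r h) ≡ rails r h
  ends-rail zero       h rewrite splitAt-↑ʳ (suc n) (n + n) (h ↑ˡ n) | splitAt-↑ˡ n h n = refl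
  ends-rail (suc zero) h rewrite splitAt-↑ʳ (suc n) (n + n) (n ↑ʳ h) | splitAt-↑ʳ n n h = refl

  degree-snake : ∀ (V : Vec ℕ (suc n)) (B T : Vec ℕ n) r k
    → degree (snakeGraph n) (V ++ (B ++ T)) (combine r k)
      ≡ lookup V k + adjacentSum 0 0 (lookup (B ∷ T ∷ []) r) k
  degree-snake V B T r k = begin
      degree (snakeGraph n) e v
    ≡⟨ edgeSum-splitAt (suc n) (n + n) (snakeEnds n) (lookup e) v ⟩
      edgeSum (snakeEnds n ∘ rungEdge) (lookup e ∘ rungEdge) v
        + edgeSum (snakeEnds n ∘ (suc n ↑ʳ_)) (lookup e ∘ (suc n ↑ʳ_)) v
    ≡⟨ cong₂ _+_ (edgeSum-cong ends-rung (lookup-++ˡ V (B ++ T)) v)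
                 (trans (edgeSum-splitAt n n (snakeEnds n ∘ (suc n ↑ʳ_)) (lookup e ∘ (suc n ↑ʳ_)) v)
                        (cong₂ _+_ (edgeSum-cong (ends-rail bottom) lookup-bottom v)
                                    (edgeSum-cong (ends-rail top) lookup-top v))) ⟩
      edgeSum rungs (lookup V) v + (edgeSum (rails bottom) (lookup B) v + edgeSum (rails top) (lookup T) v)
    ≡⟨ cong₂ _+_ (edgeSum-rungs (lookup V) r k)
                 (cong₂ _+_ (edgeSum-rails B bottom r k) (edgeSum-rails T top r k)) ⟩
      lookup V k + ((if does (bottom ≟ r) then adjacentSum 0 0 B k else 0)
                    + (if does (top ≟ r) then adjacentSum 0 0 T k else 0))
    ≡⟨ cong (lookup V k +_) (one-row r) ⟩
      lookup V k + adjacentSum 0 0 (lookup (B ∷ T ∷ []) r) k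
    ∎
    where
    open ≡-Reasoning
    e = V ++ (B ++ T)
    v = combine r k
    lookup-bottom : ∀ h → lookup e (railEdge bottom h) ≡ lookup B h
    lookup-bottom h = trans (lookup-++ʳ V (B ++ T) (h ↑ˡ n)) (lookup-++ˡ B T h)
    lookup-top : ∀ h → lookup e (railEdge top h) ≡ lookup T h
    lookup-top h = trans (lookup-++ʳ V (B ++ T) (n ↑ʳ h)) (lookup-++ʳ B T h)
    one-row : ∀ r → (if does (bottom ≟ r) then adjacentSum 0 0 B k else 0)
                    + (if does (top ≟ r) then adjacentSum 0 0 T k else 0)
                  ≡ adjacentSum 0 0 (lookup (B ∷ T ∷ []) r) k
    one-row zero       = +-identityʳ _
    one-row (suc zero) = refl

  labelOf-combine : ∀ (x : Fin (suc n) → ℕ) r k → labelOf n x (combine r k) ≡ x k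
  labelOf-combine x r k = cong (x ∘ proj₂) (remQuot-combine {2} {suc n} r k)

  snakeCover⇔ : ∀ (x : Fin (suc n) → ℕ) V B T
    → IsDimerCover (snakeGraph n) (labelOf n x) (V ++ (B ++ T))
      ⇔ (∀ r k → lookup V k + adjacentSum 0 0 (lookup (B ∷ T ∷ []) r) k ≡ x k)
  snakeCover⇔ x V B T = mk⇔
    (λ cover r k → trans (sym (degree-snake V B T r k))
                         (trans (tabulate⁻ {f = id} cover (combine r k)) (labelOf-combine x r k)))
    (λ balanced → tabulate⁺ {f = id} λ v →
       let (r , k) = remQuot {2} (suc n) v in
       subst (λ v → degree (snakeGraph n) (V ++ (B ++ T)) v ≡ labelOf n x v) (combine-remQuot {2} (suc n) v)
             (trans (degree-snake V B T r k) (trans (balanced r k) (sym (labelOf-combine x r k)))))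

  Ω-snake↔Chains : ∀ (x : Fin (suc n) → ℕ) → Ω (snakeGraph n) (labelOf n x) ↔ Σ (Vec ℕ n) (Chain x 0 0)
  Ω-snake↔Chains x =
    ↔-trans (↔-sym (Σ-↔ {A = Cover} edges-↔ ↔-refl))
            (subtype-↔ (All.irrelevant ≡-irrelevant) Chain-irrelevant (proj₁ ∘ proj₂) fill
                       (λ {t} → cover⇒chain {t}) chain⇒cover (λ {t} → fill-bottom {t}) (λ _ → refl))
    where
    edges-↔ : (Vec ℕ (suc n) × Vec ℕ n × Vec ℕ n) ↔ Vec ℕ (suc n + (n + n))
    edges-↔ = ↔-trans (×-cong ↔-refl (++-↔ n)) (++-↔ (suc n))

    Cover : Vec ℕ (suc n) × Vec ℕ n × Vec ℕ n → Set
    Cover (V , B , T) = IsDimerCover (snakeGraph n) (labelOf n x) (V ++ (B ++ T))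

    fill : Vec ℕ n → Vec ℕ (suc n) × Vec ℕ n × Vec ℕ n
    fill B = tabulate (λ k → x k ∸ adjacentSum 0 0 B k) , B , B

    cover⇒chain : ∀ {t} → Cover t → Chain x 0 0 (proj₁ (proj₂ t))
    cover⇒chain {V , B , T} cover = adjacentSum≤⇒Chain B λ k →
      subst (adjacentSum 0 0 B k ≤_) (Equivalence.to (snakeCover⇔ x V B T) cover bottom k)
            (m≤n+m _ (lookup V k))

    chain⇒cover : ∀ {B} → Chain x 0 0 B → Cover (fill B)
    chain⇒cover {B} chain = Equivalence.from (snakeCover⇔ x (proj₁ (fill B)) B B) λ r k →
      trans (cong₂ _+_ (lookup∘tabulate (λ k → x k ∸ adjacentSum 0 0 B k) k)
                       (cong (λ H → adjacentSum 0 0 H k) (same-rows r)))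
            (m∸n+n≡m (Chain⇒adjacentSum≤ B chain k))
      where
      same-rows : ∀ r → lookup (B ∷ B ∷ []) r ≡ B
      same-rows zero       = refl
      same-rows (suc zero) = refl

    fill-bottom : ∀ {t} → Cover t → fill (proj₁ (proj₂ t)) ≡ t
    fill-bottom {V , B , T} cover = cong₂ _,_ V≡ (cong (B ,_) B≡T)
      where
      balanced = Equivalence.to (snakeCover⇔ x V B T) cover
      V≡ : tabulate (λ k → x k ∸ adjacentSum 0 0 B k) ≡ V
      V≡ = trans (tabulate-cong λ k → trans (cong (_∸ adjacentSum 0 0 B k) (sym (balanced bottom k)))
                                            (m+n∸n≡m (lookup V k) (adjacentSum 0 0 B k)))
                 (tabulate∘lookup V)
      B≡T : B ≡ T
      B≡T = adjacentSum-injective B T λ k →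
        +-cancelˡ-≡ (lookup V k) _ _ (trans (balanced bottom k) (sym (balanced top k)))

modSeq-inner : ∀ n m i j k → toℕ k ≢ 0 → toℕ k ≢ n → modSeq n m i j k ≡ m k
modSeq-inner n m i j k k≢0 k≢n with toℕ k ≟ℕ 0
... | yes k≡0 = ⊥-elim (k≢0 k≡0)
... | no _ with toℕ k ≟ℕ n
...   | yes k≡n = ⊥-elim (k≢n k≡n)
...   | no _    = refl

modSeq-last : ∀ n m i j → n ≢ 0 → modSeq n m i j (fromℕ n) ≡ m (fromℕ n) ∸ toℕ j
modSeq-last n m i j n≢0 with toℕ (fromℕ n) ≟ℕ 0
... | yes n≡0 = ⊥-elim (n≢0 (trans (sym (toℕ-fromℕ n)) n≡0))
... | no _ with toℕ (fromℕ n) ≟ℕ n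
...   | yes _   = refl
...   | no n≢n  = ⊥-elim (n≢n (toℕ-fromℕ n))

Chain-modSeq : ∀ n (m : Fin (suc (suc n)) → ℕ) i j (cs : Vec ℕ (suc n))
             → Chain m (toℕ i) (toℕ j) cs ⇔ Chain (modSeq (suc n) m i j) 0 0 cs
Chain-modSeq n m i j (c ∷ cs) =
  first ×-⇔ Chain-∸-last cs (s≤s⁻¹ (toℕ<n j)) inner (modSeq-last (suc n) m i j λ ())
  where
  first : toℕ i + c ≤ m zero ⇔ c ≤ m zero ∸ toℕ i
  first rewrite +-comm (toℕ i) c = +-≤⇔≤-∸ (s≤s⁻¹ (toℕ<n i))
  inner : ∀ k → modSeq (suc n) m i j (suc (inject₁ k)) ≡ m (suc (inject₁ k))
  inner k = modSeq-inner (suc n) m i j (suc (inject₁ k)) (λ ()) (toℕ-inject₁-≢ k ∘ sym ∘ suc-injective)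

theorem1 : (n : ℕ) → 1 ≤ n → (m : Fin (suc n) → ℕ)
           → ((i : Fin (suc (m zero))) (j : Fin (suc (m (fromℕ n))))
               → HasCard (Ωij n m i j) (Mprod n m i j))
             × HasCard (Ω (snakeGraph n) (labelOf n m)) (Mprod n m zero zero)
theorem1 zero    ()
theorem1 (suc n) _  m = entry , ↔-trans (Ω-snake↔Chains m) (↔-sym (Fin-Mprod↔Chains (suc n) m zero zero))
  where
  open EquationalReasoning {k = bijection}
  entry : ∀ i j → HasCard (Ωij (suc n) m i j) (Mprod (suc n) m i j)
  entry i j = begin
      Ωij (suc n) m i j
    ↔⟨ Ω-snake↔Chains (modSeq (suc n) m i j) ⟩
      Σ (Vec ℕ (suc n)) (Chain (modSeq (suc n) m i j) 0 0)
    ↔⟨ Σ-congʳ-⇔ Chain-irrelevant Chain-irrelevant (⇔-sym (Chain-modSeq n m i j _)) ⟩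
      Σ (Vec ℕ (suc n)) (Chain m (toℕ i) (toℕ j))
    ↔⟨ ↔-sym (Fin-Mprod↔Chains (suc n) m i j) ⟩
      Fin (Mprod (suc n) m i j)
    ∎
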